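{- Let $(G,w)$ be a connected weighted graph with metrizable weight $w$ such that for every two distinct nonadjacent vertices $u,v$ and each vertex $p$ with $u\ne p\ne v$, either both $\{u,p\},\{v,p\}\in E(G)$ or both $\{u,p\},\{v,p\}\notin E(G)$. Let $x,y$ be distinct nonadjacent vertices of $G$. Then for every path $P$ in $G$ joining $x$ and $y$ there is $v\in V(G)$ with $\{v,x\},\{v,y\}\in E(G)$ such that $$\max_{e\in E(P)}\big(2w(e)-w(P)\big)_+\le |w(\{x,v\})-w(\{v,y\})|.$$
   Context: Graphs are simple, possibly infinite; paths are finite. $w(P)=\sum_{e\in E(P)}w(e)$. A weight $w:E(G)\to[0,\infty)$ is metrizable if there is a pseudometric $d$ on $V(G)$ with $d(u,v)=w(\{u,v\})$ for all edges. $t_+=t$ if $t\ge0$ and $t_+=0$ if $t<0$. -}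

module Defs where

open import Level using (0ℓ)
open import Data.Product using (Σ; ∃; _×_; _,_; proj₁)
open import Data.List using (List; []; _∷_; foldr)
open import Data.List.Relation.Unary.Unique.Propositional using (Unique)
open import Relation.Binary.PropositionalEquality using (_≡_)
open import Relation.Binary.Structures using (IsTotalOrder)
open import Algebra.Structures using (IsCommutativeRing)
open import Relation.Nullary using (¬_)

-- The real numbers, axiomatised as a complete (Dedekind / least upper
-- bound) totally ordered field.  Every model is isomorphic to ℝ, so
-- quantifying over all models is the same as working in ℝ.

record Reals : Set₁ where
  infixl 6 _+_ _-_
  infixl 7 _*_
  infix  4 _≤_
  infixl 6 _⊔_
  field
    R        : Set
    0r 1r    : R
    _+_ _*_  : R → R → R
    -_       : R → R
    _≤_      : R → R → Set
    isCommutativeRing : IsCommutativeRing _≡_ _+_ _*_ -_ 0r 1r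
    isTotalOrder      : IsTotalOrder _≡_ _≤_
    0≢1      : ¬ (0r ≡ 1r)
    inv      : (x : R) → ¬ (x ≡ 0r) → R
    inv-*    : (x : R) (p : ¬ (x ≡ 0r)) → x * inv x p ≡ 1r
    +-mono-≤ : ∀ {x y} z → x ≤ y → x + z ≤ y + z
    *-pos    : ∀ {x y} → 0r ≤ x → 0r ≤ y → 0r ≤ x * y
    lub      : (S : R → Set) → ∃ S → ∃ (λ b → ∀ x → S x → x ≤ b) →
               ∃ (λ s → (∀ x → S x → x ≤ s) ×
                        (∀ b → (∀ x → S x → x ≤ b) → s ≤ b))
    -- binary maximum (uniquely determined by the order)
    _⊔_      : R → R → R
    x≤x⊔y    : ∀ x y → x ≤ x ⊔ y
    y≤x⊔y    : ∀ x y → y ≤ x ⊔ y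
    ⊔-least  : ∀ {x y z} → x ≤ z → y ≤ z → x ⊔ y ≤ z

  _-_ : R → R → R
  x - y = x + (- y)

  _₊ : R → R
  t ₊ = t ⊔ 0r

  ∣_∣ : R → R
  ∣ t ∣ = t ⊔ (- t)

record Graph : Set₁ where
  field
    V       : Set
    E       : V → V → Set
    E-sym   : ∀ {u v} → E u v → E v u
    E-irr   : ∀ {u} → ¬ E u u

module _ (ℝ : Reals) (G : Graph) where
  open Reals ℝ
  open Graph G

  data Walk : V → V → Set where
    [] : ∀ {x} → Walk x x
    _∷_ : ∀ {x z y} → E x z → Walk z y → Walk x y

  vertices : ∀ {x y} → Walk x y → List V
  vertices {x} [] = x ∷ []
  vertices {x} (e ∷ p) = x ∷ vertices p

  record Path (x y : V) : Set where
    constructor path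
    field
      walk     : Walk x y
      distinct : Unique (vertices walk)

  Weight : Set
  Weight = ∀ {u v} → E u v → R

  IsPseudometric : (V → V → R) → Set
  IsPseudometric d = (∀ x → d x x ≡ 0r) × (∀ x y → d x y ≡ d y x)
                   × (∀ x y z → d x z ≤ d x y + d y z)

  Metrizable : Weight → Set
  Metrizable w = ∃ λ d → IsPseudometric d × (∀ {u v} (e : E u v) → d u v ≡ w e)

  NonNegative : Weight → Set
  NonNegative w = ∀ {u v} (e : E u v) → 0r ≤ w e

  edgeWeights : Weight → ∀ {x y} → Walk x y → List R
  edgeWeights w [] = []
  edgeWeights w (e ∷ p) = w e ∷ edgeWeights w p

  walkWeight : Weight → ∀ {x y} → Walk x y → R
  walkWeight w p = foldr _+_ 0r (edgeWeights w p)

  -- max_{e ∈ E(P)} (2 w(e) - w(P))₊   (all terms are ≥ 0, so 0 is a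
  -- neutral start value; P has ≥ 1 edge in the application anyway)
  maxExcess : Weight → ∀ {x y} → Path x y → R
  maxExcess w (path p _) =
    foldr (λ a acc → ((a + a) - walkWeight w p) ₊ ⊔ acc) 0r (edgeWeights w p)

  Connected : Set
  Connected = ∀ x y → Path x y

-- Let v be the second vertex of P.  It is adjacent to x and distinct from
-- the nonadjacent y, so the hypothesis on nonadjacent pairs makes it
-- adjacent to y as well.  In a walk T from u to y every edge a satisfies
-- 2a − w(T) ≤ d(u,y), because the other edges of T connect the endpoints
-- of a to u and y.  Splitting P = xv · T, the first edge therefore has
-- excess w(xv) − w(T) ≤ d(x,v) − d(v,y), and every later edge a has excess
-- (2a − w(T)) − w(xv) ≤ d(v,y) − d(x,v).
module Submission where

open import Defs
open import Data.Product using (Σ; ∃; _×_; _,_; proj₁; proj₂)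
open import Data.Sum using (_⊎_; inj₁; inj₂)
open import Data.Empty using (⊥-elim)
open import Data.List using (List; []; _∷_; foldr)
open import Data.List.Relation.Unary.All as All using (All; []; _∷_)
open import Relation.Binary.PropositionalEquality
  using (_≡_; refl; sym; trans; cong; cong₂)
open import Relation.Binary.Structures using (IsTotalOrder)
open import Relation.Binary.Bundles using (Poset)
open import Relation.Nullary using (¬_)
open import Algebra.Bundles using (CommutativeRing)
open import Algebra.Structures using (IsCommutativeRing)

module OrderedFieldProperties (ℝ : Reals) where
  open Reals ℝ renaming (+-mono-≤ to +-monoˡ-≤)
  open IsTotalOrder isTotalOrder using (total)
  open IsTotalOrder isTotalOrder public using () renaming (trans to ≤-trans; reflexive to ≤-reflexive)
  open IsCommutativeRing isCommutativeRing using (+-assoc; +-comm; +-identityˡ; -‿inverseʳ)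

  commutativeRing : CommutativeRing _ _
  commutativeRing = record { isCommutativeRing = isCommutativeRing }

  poset : Poset _ _ _
  poset = record { isPartialOrder = IsTotalOrder.isPartialOrder isTotalOrder }

  open import Algebra.Properties.AbelianGroup (CommutativeRing.+-abelianGroup commutativeRing)
    using (ε⁻¹≈ε; ⁻¹-anti-homo‿-; ⁻¹-anti-homo-∙; xyx⁻¹≈y)
    public
  open import Relation.Binary.Reasoning.PartialOrder poset

  +-monoʳ-≤ : ∀ {x y} z → x ≤ y → z + x ≤ z + y
  +-monoʳ-≤ {x} {y} z x≤y = begin
    z + x ≡⟨ +-comm z x ⟩
    x + z ≤⟨ +-monoˡ-≤ z x≤y ⟩
    y + z ≡⟨ +-comm y z ⟩
    z + y ∎

  +-mono-≤ : ∀ {x y u v} → x ≤ y → u ≤ v → x + u ≤ y + v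
  +-mono-≤ {y = y} {u = u} x≤y u≤v = ≤-trans (+-monoˡ-≤ u x≤y) (+-monoʳ-≤ y u≤v)

  neg-mono-≤ : ∀ {x y} → x ≤ y → - y ≤ - x
  neg-mono-≤ {x} {y} x≤y = begin
    - y             ≡⟨ sym (xyx⁻¹≈y x (- y)) ⟩
    x + - y + - x   ≤⟨ +-monoˡ-≤ (- x) (+-monoˡ-≤ (- y) x≤y) ⟩
    y + - y + - x   ≡⟨ cong (_+ - x) (-‿inverseʳ y) ⟩
    0r + - x        ≡⟨ +-identityˡ (- x) ⟩
    - x             ∎

  -‿mono-≤ : ∀ {x y u v} → x ≤ y → v ≤ u → x - u ≤ y - v
  -‿mono-≤ x≤y v≤u = +-mono-≤ x≤y (neg-mono-≤ v≤u)

  x≤y+z⇒x-z≤y : ∀ {x y z} → x ≤ y + z → x - z ≤ y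
  x≤y+z⇒x-z≤y {x} {y} {z} x≤y+z = begin
    x - z           ≤⟨ +-monoˡ-≤ (- z) x≤y+z ⟩
    y + z + - z     ≡⟨ trans (cong (_+ - z) (+-comm y z)) (xyx⁻¹≈y z y) ⟩
    y               ∎

  x+x-[x+y]≡x-y : ∀ x y → (x + x) - (x + y) ≡ x - y
  x+x-[x+y]≡x-y x y = begin-equality
    (x + x) + - (x + y)   ≡⟨ cong ((x + x) +_) (⁻¹-anti-homo-∙ x y) ⟩
    (x + x) + (- y + - x) ≡⟨ +-assoc x x (- y + - x) ⟩
    x + (x + (- y + - x)) ≡⟨ cong (x +_) (sym (+-assoc x (- y) (- x))) ⟩
    x + (x + - y + - x)   ≡⟨ cong (x +_) (xyx⁻¹≈y x (- y)) ⟩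
    x - y                 ∎

  x-[y+z]≡x-z-y : ∀ x y z → x - (y + z) ≡ (x - z) - y
  x-[y+z]≡x-z-y x y z = trans (cong (x +_) (⁻¹-anti-homo-∙ y z)) (sym (+-assoc x (- z) (- y)))

  x≤∣x∣ : ∀ x → x ≤ ∣ x ∣
  x≤∣x∣ x = x≤x⊔y x (- x)

  -x≤∣x∣ : ∀ x → - x ≤ ∣ x ∣
  -x≤∣x∣ x = y≤x⊔y x (- x)

  0≤∣x∣ : ∀ x → 0r ≤ ∣ x ∣
  0≤∣x∣ x with total 0r x
  ... | inj₁ 0≤x = ≤-trans 0≤x (x≤∣x∣ x)
  ... | inj₂ x≤0 = begin
    0r    ≡⟨ sym ε⁻¹≈ε ⟩
    - 0r  ≤⟨ neg-mono-≤ x≤0 ⟩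
    - x   ≤⟨ -x≤∣x∣ x ⟩
    ∣ x ∣ ∎

  ∣x∣-least : ∀ {x y} → x ≤ y → - x ≤ y → ∣ x ∣ ≤ y
  ∣x∣-least = ⊔-least

  x≤∣y∣⇒x₊≤∣y∣ : ∀ {x} y → x ≤ ∣ y ∣ → x ₊ ≤ ∣ y ∣
  x≤∣y∣⇒x₊≤∣y∣ y x≤∣y∣ = ⊔-least x≤∣y∣ (0≤∣x∣ y)

  foldr-⊔-least : ∀ (f : R → R) {b} (xs : List R) → 0r ≤ b → All (λ x → f x ≤ b) xs →
                  foldr (λ x acc → f x ⊔ acc) 0r xs ≤ b
  foldr-⊔-least f []       0≤b []            = 0≤b
  foldr-⊔-least f (x ∷ xs) 0≤b (fx≤b ∷ fxs≤b) = ⊔-least fx≤b (foldr-⊔-least f xs 0≤b fxs≤b)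

module PseudometricWalks (ℝ : Reals) (G : Graph) (w : Weight ℝ G)
       {d : Graph.V G → Graph.V G → Reals.R ℝ} (isPseudometric : IsPseudometric ℝ G d)
       (d≡w : ∀ {u v} (e : Graph.E G u v) → d u v ≡ w e) where
  open Reals ℝ hiding (+-mono-≤)
  open Graph G
  open OrderedFieldProperties ℝ
  open IsCommutativeRing isCommutativeRing using (+-comm)
  open import Relation.Binary.Reasoning.PartialOrder poset

  private
    W : ∀ {x y} → Walk ℝ G x y → R
    W = walkWeight ℝ G w

    d-refl : ∀ x → d x x ≡ 0r
    d-refl = proj₁ isPseudometric

    d-sym : ∀ x y → d x y ≡ d y x
    d-sym = proj₁ (proj₂ isPseudometric)

    d-triangle : ∀ x y z → d x z ≤ d x y + d y z
    d-triangle = proj₂ (proj₂ isPseudometric)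

  d≤walkWeight : ∀ {u y} (T : Walk ℝ G u y) → d u y ≤ W T
  d≤walkWeight {u} [] = ≤-reflexive (d-refl u)
  d≤walkWeight {u} {y} (_∷_ {z = z} e T) = begin
    d u y         ≤⟨ d-triangle u z y ⟩
    d u z + d z y ≤⟨ +-mono-≤ (≤-reflexive (d≡w e)) (d≤walkWeight T) ⟩
    w e + W T     ∎

  ∣d-d∣≤d : ∀ x y z → ∣ d x y - d y z ∣ ≤ d x z
  ∣d-d∣≤d x y z = ∣x∣-least (x≤y+z⇒x-z≤y upper) (begin
    - (d x y - d y z) ≡⟨ ⁻¹-anti-homo‿- (d x y) (d y z) ⟩
    d y z - d x y     ≤⟨ x≤y+z⇒x-z≤y lower ⟩
    d x z             ∎)
    where
    upper : d x y ≤ d x z + d y z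
    upper = begin
      d x y         ≤⟨ d-triangle x z y ⟩
      d x z + d z y ≡⟨ cong (d x z +_) (d-sym z y) ⟩
      d x z + d y z ∎
    lower : d y z ≤ d x z + d x y
    lower = begin
      d y z         ≤⟨ d-triangle y x z ⟩
      d y x + d x z ≡⟨ cong (_+ d x z) (d-sym y x) ⟩
      d x y + d x z ≡⟨ +-comm (d x y) (d x z) ⟩
      d x z + d x y ∎

  mutual
    excess≤∣d-d∣ : ∀ {x v y} (e : E x v) (T : Walk ℝ G v y) →
                   All (λ a → (a + a) - W (e ∷ T) ≤ ∣ d x v - d v y ∣) (edgeWeights ℝ G w (e ∷ T))
    excess≤∣d-d∣ {x} {v} {y} e T = first ∷ All.map later (excess≤d T)
      where
      first : (w e + w e) - (w e + W T) ≤ ∣ d x v - d v y ∣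
      first = begin
        (w e + w e) - (w e + W T) ≡⟨ x+x-[x+y]≡x-y (w e) (W T) ⟩
        w e - W T                 ≤⟨ -‿mono-≤ (≤-reflexive (sym (d≡w e))) (d≤walkWeight T) ⟩
        d x v - d v y             ≤⟨ x≤∣x∣ (d x v - d v y) ⟩
        ∣ d x v - d v y ∣         ∎
      later : ∀ {a} → (a + a) - W T ≤ d v y → (a + a) - (w e + W T) ≤ ∣ d x v - d v y ∣
      later {a} excess≤ = begin
        (a + a) - (w e + W T) ≡⟨ x-[y+z]≡x-z-y (a + a) (w e) (W T) ⟩
        ((a + a) - W T) - w e ≤⟨ -‿mono-≤ excess≤ (≤-reflexive (d≡w e)) ⟩
        d v y - d x v         ≡⟨ sym (⁻¹-anti-homo‿- (d x v) (d v y)) ⟩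
        - (d x v - d v y)     ≤⟨ -x≤∣x∣ (d x v - d v y) ⟩
        ∣ d x v - d v y ∣     ∎

    excess≤d : ∀ {u y} (T : Walk ℝ G u y) → All (λ a → (a + a) - W T ≤ d u y) (edgeWeights ℝ G w T)
    excess≤d [] = []
    excess≤d {u} {y} (_∷_ {z = z} e T) = All.map (λ ≤∣d-d∣ → ≤-trans ≤∣d-d∣ (∣d-d∣≤d u z y)) (excess≤∣d-d∣ e T)

module _ (G : Graph) where
  open Graph G

  NonadjacentTwins : Set
  NonadjacentTwins = ∀ u v p → ¬ (u ≡ v) → ¬ E u v → ¬ (u ≡ p) → ¬ (p ≡ v) →
                     (E u p × E v p) ⊎ (¬ E u p × ¬ E v p)

  neighbour-of-nonadjacent : NonadjacentTwins → ∀ {x y v} → ¬ (x ≡ y) → ¬ E x y → E x v → E v y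
  neighbour-of-nonadjacent twins {x} {y} {v} x≢y ¬Exy Exv
    with twins x y v x≢y ¬Exy (λ { refl → E-irr Exv }) (λ { refl → ¬Exy Exv })
  ... | inj₁ (_ , Eyv)  = E-sym Eyv
  ... | inj₂ (¬Exv , _) = ⊥-elim (¬Exv Exv)

lemma4p6 : (ℝ : Reals) (G : Graph) →
    let open Reals ℝ
        open Graph G
    in (w : Weight ℝ G) → NonNegative ℝ G w → Metrizable ℝ G w →
       Connected ℝ G →
       (∀ u v p → ¬ (u ≡ v) → ¬ E u v → ¬ (u ≡ p) → ¬ (p ≡ v) →
          (E u p × E v p) ⊎ (¬ E u p × ¬ E v p)) →
       ∀ x y → ¬ (x ≡ y) → ¬ E x y →
       (P : Path ℝ G x y) →
       ∃ λ v → Σ (E v x) λ evx → Σ (E v y) λ evy →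
         maxExcess ℝ G w P ≤ ∣ w (E-sym evx) - w evy ∣
lemma4p6 ℝ G w _ _ _ _ x y x≢y _ (path [] _) = ⊥-elim (x≢y refl)
lemma4p6 ℝ G w _ (d , isPseudometric , d≡w) _ twins x y x≢y ¬Exy (path (_∷_ {z = v} e T) distinct) =
  v , E-sym e , Evy , (begin
    maxExcess ℝ G w (path (e ∷ T) distinct)
      ≤⟨ foldr-⊔-least _ (edgeWeights ℝ G w (e ∷ T)) (0≤∣x∣ _)
           (All.map (x≤∣y∣⇒x₊≤∣y∣ _) (excess≤∣d-d∣ e T)) ⟩
    ∣ d x v - d v y ∣
      ≡⟨ cong ∣_∣ (cong₂ _-_ (d≡w (E-sym (E-sym e))) (d≡w Evy)) ⟩
    ∣ w (E-sym (E-sym e)) - w Evy ∣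
      ∎)
  where
  open Reals ℝ
  open Graph G
  open OrderedFieldProperties ℝ
  open PseudometricWalks ℝ G w isPseudometric d≡w
  open import Relation.Binary.Reasoning.PartialOrder poset
  Evy : E v y
  Evy = neighbour-of-nonadjacent G twins x≢y ¬Exy e
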